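{- Fix a positive integer $d$. For $n\geq 0$ let $\mathcal{M}_d(n)$ be the set of molecules with $n$ nuclei of length $d$, i.e. the set of types $\mathbf{k}=(k_0,d,k_1,d,\ldots,k_{n-1},d,k_n)$ with $k_0,\ldots,k_n$ nonnegative integers (so $\mathcal{M}_d(n)$ is in bijection with $\mathbb{N}^{n+1}$). For $0\leq j\leq n-1$ define the insertion $\circ_j:\mathcal{M}_d(n)\times\mathcal{M}_d(m)\to\mathcal{M}_d(n+m-1)$ by replacing the $(j+1)$-st nucleus of the first molecule by the second molecule: $$(k_0,d,\ldots,d,k_n)\circ_j(l_0,d,\ldots,d,l_m)=(k_0,d,\ldots,k_{j-1},d,\,k_j+l_0,\,d,l_1,d,\ldots,d,l_{m-1},d,\,l_m+k_{j+1},\,d,k_{j+2},\ldots,d,k_n)$$ (for $m=0$ the entries $k_j,l_0,k_{j+1}$ merge into the single entry $k_j+l_0+k_{j+1}$). Let $e_n\in\mathcal{M}_d(n)$ be the molecule without electrons, of type $(0,d,0,\ldots,0,d,0)$. Then $(\mathcal{M}_d,e_0,e_2)$ is an operad with multiplication, i.e. $\mathcal{M}_d$ with these insertions and unit $e_1$ is a planar operad, $e_2\circ_0e_2=e_2\circ_1e_2$, and $e_2\circ_0e_0=e_2\circ_1e_0=e_1$.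
   Context: For a type $\mathbf{k}=(k_0,d,k_1,\ldots,d,k_n)$ put $N(\mathbf{k})=nd+\sum_i k_i$; the molecule of type $\mathbf{k}$ is the interval $[N(\mathbf{k})]$ divided into $n$ consecutive subintervals ("nuclei", consisting of "protons") of length $d$, the nucleus number $j$ being $k_0+\cdots+k_{j-1}+(j-1)d+[d]$, separated by blocks of $k_0,\ldots,k_n$ remaining elements ("electrons"). A planar operad in sets is a collection of sets $\mathcal{O}(n)$, $n\geq0$, with a unit $1\in\mathcal{O}(1)$ and insertion maps $\circ_j:\mathcal{O}(n)\times\mathcal{O}(m)\to\mathcal{O}(n+m-1)$, $0\leq j\leq n-1$, satisfying the usual associativity and unit identities for partial compositions. An operad with multiplication is a planar operad $\mathcal{O}$ with elements $e\in\mathcal{O}(0)$, $\mu\in\mathcal{O}(2)$ such that $\mu\circ_0\mu=\mu\circ_1\mu$ and $\mu\circ_0e=\mu\circ_1e=1$. -}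

module Defs where

open import Data.Nat using (ℕ; zero; suc; _+_; _∸_; _<_)
open import Data.Nat.Properties using (+-comm; +-assoc; +-suc)
open import Data.Fin using (Fin; zero; suc; toℕ)
open import Data.Vec using (Vec; []; _∷_; _++_; cast; replicate)
open import Relation.Binary.PropositionalEquality using (_≡_; cong; subst; sym; trans)

swap-arity : ∀ a b c → a + b + c ≡ a + c + b
swap-arity a b c =
  trans (+-assoc a b c) (trans (cong (a +_) (+-comm b c)) (sym (+-assoc a c b)))

record IsPlanarOperad (O : ℕ → Set) (one : O 1)
    (_∘[_]_ : ∀ {n m} → O (suc n) → Fin (suc n) → O m → O (n + m)) : Set where
  field
    unitˡ : ∀ {m} (f : O m) → one ∘[ zero ] f ≡ f
    unitʳ : ∀ {n} (f : O (suc n)) (i : Fin (suc n)) →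
            subst O (+-comm n 1) (f ∘[ i ] one) ≡ f
    seqAssoc : ∀ {a b c} (f : O (suc a)) (g : O (suc b)) (h : O c)
               (i : Fin (suc a)) (j : Fin (suc b)) (k : Fin (suc (a + b))) →
               toℕ k ≡ toℕ i + toℕ j →
               (subst O (+-suc a b) (f ∘[ i ] g)) ∘[ k ] h
                 ≡ subst O (sym (+-assoc a b c)) (f ∘[ i ] (g ∘[ j ] h))
    parAssoc : ∀ {a b c} (f : O (suc (suc a))) (g : O b) (h : O c)
               (i j : Fin (suc (suc a))) → toℕ i < toℕ j →
               (j' : Fin (suc (a + b))) → toℕ j' ≡ toℕ j + b ∸ 1 →
               (i' : Fin (suc (a + c))) → toℕ i' ≡ toℕ i →
               subst O (swap-arity a b c) ((f ∘[ i ] g) ∘[ j' ] h)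
                 ≡ (f ∘[ j ] h) ∘[ i' ] g

record IsOperadWithMultiplication (O : ℕ → Set) (one : O 1)
    (_∘[_]_ : ∀ {n m} → O (suc n) → Fin (suc n) → O m → O (n + m))
    (e : O 0) (μ : O 2) : Set where
  field
    isPlanarOperad : IsPlanarOperad O one _∘[_]_
    μ-assoc : μ ∘[ zero ] μ ≡ μ ∘[ suc zero ] μ
    μ-unitˡ : μ ∘[ zero ] e ≡ one
    μ-unitʳ : μ ∘[ suc zero ] e ≡ one

-- Molecules with n nuclei of length d: type (k₀,d,k₁,…,d,kₙ) is recorded
-- by the electron counts (k₀,…,kₙ) ∈ ℕ^(n+1); d is fixed.

record Molecule (d n : ℕ) : Set where
  constructor mol
  field
    electrons : Vec ℕ (suc n)

addLast : ∀ {m} → ℕ → Vec ℕ (suc m) → Vec ℕ (suc m)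
addLast b (x ∷ []) = x + b ∷ []
addLast b (x ∷ y ∷ ys) = x ∷ addLast b (y ∷ ys)

glue : ∀ {m} → ℕ → Vec ℕ (suc m) → ℕ → Vec ℕ (suc m)
glue a (x ∷ xs) b = addLast b (a + x ∷ xs)

-- replace nucleus number j+1 (between k_j and k_{j+1}) by the molecule l
insertVec : ∀ {n m} → Vec ℕ (suc (suc n)) → Fin (suc n) → Vec ℕ (suc m) →
            Vec ℕ (suc (n + m))
insertVec {n} {m} (k₀ ∷ k₁ ∷ ks) zero l =
  cast (cong suc (+-comm m n)) (glue k₀ l k₁ ++ ks)
insertVec {suc n} (k₀ ∷ ks) (suc j) l = k₀ ∷ insertVec ks j l

_∘ᴹ[_]_ : ∀ {d n m} → Molecule d (suc n) → Fin (suc n) → Molecule d m →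
          Molecule d (n + m)
mol k ∘ᴹ[ j ] mol l = mol (insertVec k j l)

eᴹ : ∀ d n → Molecule d n
eᴹ d n = mol (replicate (suc n) 0)

-- A molecule of type (k₀,d,k₁,…,d,kₙ) is the word eᵏ⁰ N eᵏ¹ N ⋯ N eᵏⁿ in electrons e and
-- nuclei N, and this encoding is injective. Under it, ∘ⱼ becomes the substitution of a word
-- for the j-th letter N, so the operad axioms reduce to elementary identities about
-- substituting words for letters of a word.
module Submission where

open import Defs
open import Data.Nat using (ℕ; zero; suc; pred; _+_; _∸_; _<_; _≤_; s≤s)
open import Data.Nat.Properties using (+-comm; +-assoc; +-suc)
open import Data.List using (List; []; _∷_; _++_; [_]; replicate; concatMap; length)
open import Data.List.Properties using (++-assoc; ++-identityʳ; concatMap-++)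
open import Data.Fin using (Fin; zero; suc; toℕ)
open import Data.Fin.Properties using (toℕ<n)
open import Data.Vec as Vec using (Vec; []; _∷_; toList)
open import Data.Vec.Properties using (toList-injective; toList-++; toList-cast; length-toList; cast-is-id)
open import Relation.Binary.PropositionalEquality using (_≡_; refl; sym; trans; cong; cong₂; subst; module ≡-Reasoning)
open ≡-Reasoning

data Particle : Set where
  electron nucleus : Particle

Word : Set
Word = List Particle

electrons : ℕ → Word
electrons k = replicate k electron

electrons-+ : ∀ a b → electrons (a + b) ≡ electrons a ++ electrons b
electrons-+ zero    b = refl
electrons-+ (suc a) b = cong (electron ∷_) (electrons-+ a b)

nucleiThenElectrons : List ℕ → Word
nucleiThenElectrons = concatMap (λ k → nucleus ∷ electrons k)

word : ∀ {n} → Vec ℕ (suc n) → Word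
word (k ∷ ks) = electrons k ++ nucleiThenElectrons (toList ks)

nucleiThenElectrons-toList : ∀ {n} (v : Vec ℕ (suc n)) →
  nucleiThenElectrons (toList v) ≡ nucleus ∷ word v
nucleiThenElectrons-toList (k ∷ ks) = refl

incrementHead : List ℕ → List ℕ
incrementHead []       = []
incrementHead (k ∷ ks) = suc k ∷ ks

decode : Word → List ℕ
decode []             = 0 ∷ []
decode (electron ∷ u) = incrementHead (decode u)
decode (nucleus ∷ u)  = 0 ∷ decode u

decode-word : ∀ k ks → decode (electrons k ++ nucleiThenElectrons ks) ≡ k ∷ ks
decode-word (suc k) ks       = cong incrementHead (decode-word k ks)
decode-word zero    []       = refl
decode-word zero    (l ∷ ls) = cong (0 ∷_) (decode-word l ls)

word-injective : ∀ {n} (u v : Vec ℕ (suc n)) → word u ≡ word v → u ≡ v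
word-injective u@(k ∷ ks) v@(l ∷ ls) eq =
  trans (sym (cast-is-id refl u)) (toList-injective refl u v (begin
  k ∷ toList ks  ≡⟨ decode-word k (toList ks) ⟨
  decode (word (k ∷ ks))  ≡⟨ cong decode eq ⟩
  decode (word (l ∷ ls))  ≡⟨ decode-word l (toList ls) ⟩
  l ∷ toList ls  ∎))

nuclei : Word → ℕ
nuclei []             = 0
nuclei (electron ∷ u) = nuclei u
nuclei (nucleus ∷ u)  = suc (nuclei u)

nuclei-++ : ∀ u v → nuclei (u ++ v) ≡ nuclei u + nuclei v
nuclei-++ []             v = refl
nuclei-++ (electron ∷ u) v = nuclei-++ u v
nuclei-++ (nucleus ∷ u)  v = cong suc (nuclei-++ u v)

nuclei-electrons : ∀ k → nuclei (electrons k) ≡ 0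
nuclei-electrons zero    = refl
nuclei-electrons (suc k) = nuclei-electrons k

nuclei-nucleiThenElectrons : ∀ ks → nuclei (nucleiThenElectrons ks) ≡ length ks
nuclei-nucleiThenElectrons []       = refl
nuclei-nucleiThenElectrons (k ∷ ks) = cong suc (begin
  nuclei (electrons k ++ nucleiThenElectrons ks)
    ≡⟨ nuclei-++ (electrons k) (nucleiThenElectrons ks) ⟩
  nuclei (electrons k) + nuclei (nucleiThenElectrons ks)
    ≡⟨ cong₂ _+_ (nuclei-electrons k) (nuclei-nucleiThenElectrons ks) ⟩
  length ks ∎)

nuclei-word : ∀ {n} (v : Vec ℕ (suc n)) → nuclei (word v) ≡ n
nuclei-word (k ∷ ks) = begin
  nuclei (electrons k ++ nucleiThenElectrons (toList ks))
    ≡⟨ nuclei-++ (electrons k) (nucleiThenElectrons (toList ks)) ⟩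
  nuclei (electrons k) + nuclei (nucleiThenElectrons (toList ks))
    ≡⟨ cong₂ _+_ (nuclei-electrons k) (nuclei-nucleiThenElectrons (toList ks)) ⟩
  length (toList ks)
    ≡⟨ length-toList ks ⟩
  _ ∎

substitute : Word → ℕ → Word → Word
substitute []             j       v = []
substitute (electron ∷ u) j       v = electron ∷ substitute u j v
substitute (nucleus ∷ u)  zero    v = v ++ u
substitute (nucleus ∷ u)  (suc j) v = nucleus ∷ substitute u j v

substitute-electrons-++ : ∀ k u j v →
  substitute (electrons k ++ u) j v ≡ electrons k ++ substitute u j v
substitute-electrons-++ zero    u j v = refl
substitute-electrons-++ (suc k) u j v = cong (electron ∷_) (substitute-electrons-++ k u j v)

substitute-++ˡ : ∀ u w j v → j < nuclei u →
  substitute (u ++ w) j v ≡ substitute u j v ++ w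
substitute-++ˡ (electron ∷ u) w j       v j<n       = cong (electron ∷_) (substitute-++ˡ u w j v j<n)
substitute-++ˡ (nucleus ∷ u)  w zero    v _         = sym (++-assoc v u w)
substitute-++ˡ (nucleus ∷ u)  w (suc j) v (s≤s j<n) = cong (nucleus ∷_) (substitute-++ˡ u w j v j<n)

substitute-++ʳ : ∀ u w j v →
  substitute (u ++ w) (nuclei u + j) v ≡ u ++ substitute w j v
substitute-++ʳ []             w j v = refl
substitute-++ʳ (electron ∷ u) w j v = cong (electron ∷_) (substitute-++ʳ u w j v)
substitute-++ʳ (nucleus ∷ u)  w j v = cong (nucleus ∷_) (substitute-++ʳ u w j v)

substitute-nucleus : ∀ u j → substitute u j [ nucleus ] ≡ u
substitute-nucleus []             j       = refl
substitute-nucleus (electron ∷ u) j       = cong (electron ∷_) (substitute-nucleus u j)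
substitute-nucleus (nucleus ∷ u)  zero    = refl
substitute-nucleus (nucleus ∷ u)  (suc j) = cong (nucleus ∷_) (substitute-nucleus u j)

substitute-seqAssoc : ∀ u i v j w → j < nuclei v →
  substitute (substitute u i v) (i + j) w ≡ substitute u i (substitute v j w)
substitute-seqAssoc []             i       v j w _   = refl
substitute-seqAssoc (electron ∷ u) i       v j w j<n = cong (electron ∷_) (substitute-seqAssoc u i v j w j<n)
substitute-seqAssoc (nucleus ∷ u)  zero    v j w j<n = substitute-++ˡ v u j w j<n
substitute-seqAssoc (nucleus ∷ u)  (suc i) v j w j<n = cong (nucleus ∷_) (substitute-seqAssoc u i v j w j<n)

substitute-parAssoc : ∀ u i j v w → i ≤ j →
  substitute (substitute u i v) (j + nuclei v) w ≡ substitute (substitute u (suc j) w) i v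
substitute-parAssoc []             i       j       v w _         = refl
substitute-parAssoc (electron ∷ u) i       j       v w i≤j       =
  cong (electron ∷_) (substitute-parAssoc u i j v w i≤j)
substitute-parAssoc (nucleus ∷ u)  zero    j       v w _         = begin
  substitute (v ++ u) (j + nuclei v) w  ≡⟨ cong (λ k → substitute (v ++ u) k w) (+-comm j (nuclei v)) ⟩
  substitute (v ++ u) (nuclei v + j) w  ≡⟨ substitute-++ʳ v u j w ⟩
  v ++ substitute u j w                 ∎
substitute-parAssoc (nucleus ∷ u)  (suc i) (suc j) v w (s≤s i≤j) =
  cong (nucleus ∷_) (substitute-parAssoc u i j v w i≤j)

word-cast : ∀ {m n} .(eq : suc m ≡ suc n) (v : Vec ℕ (suc m)) → word (Vec.cast eq v) ≡ word v
word-cast eq (k ∷ ks) = cong (λ l → electrons k ++ nucleiThenElectrons l) (toList-cast (cong pred eq) ks)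

word-++ : ∀ {m n} (u : Vec ℕ (suc m)) (ks : Vec ℕ n) →
  word (u Vec.++ ks) ≡ word u ++ nucleiThenElectrons (toList ks)
word-++ (l ∷ ls) ks = begin
  electrons l ++ nucleiThenElectrons (toList (ls Vec.++ ks))
    ≡⟨ cong (λ x → electrons l ++ nucleiThenElectrons x) (toList-++ ls ks) ⟩
  electrons l ++ nucleiThenElectrons (toList ls ++ toList ks)
    ≡⟨ cong (electrons l ++_) (concatMap-++ _ (toList ls) (toList ks)) ⟩
  electrons l ++ (nucleiThenElectrons (toList ls) ++ nucleiThenElectrons (toList ks))
    ≡⟨ ++-assoc (electrons l) _ _ ⟨
  word (l ∷ ls) ++ nucleiThenElectrons (toList ks) ∎

word-addLast : ∀ {m} b (v : Vec ℕ (suc m)) → word (addLast b v) ≡ word v ++ electrons b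
word-addLast b (k ∷ []) = begin
  electrons (k + b) ++ []       ≡⟨ ++-identityʳ _ ⟩
  electrons (k + b)             ≡⟨ electrons-+ k b ⟩
  electrons k ++ electrons b    ≡⟨ cong (_++ electrons b) (++-identityʳ (electrons k)) ⟨
  (electrons k ++ []) ++ electrons b ∎
word-addLast b (k ∷ l ∷ ls) = begin
  electrons k ++ nucleiThenElectrons (toList (addLast b (l ∷ ls)))
    ≡⟨ cong (electrons k ++_) (nucleiThenElectrons-toList (addLast b (l ∷ ls))) ⟩
  electrons k ++ nucleus ∷ word (addLast b (l ∷ ls))
    ≡⟨ cong (λ x → electrons k ++ nucleus ∷ x) (word-addLast b (l ∷ ls)) ⟩
  electrons k ++ nucleus ∷ (word (l ∷ ls) ++ electrons b)
    ≡⟨ ++-assoc (electrons k) (nucleus ∷ word (l ∷ ls)) (electrons b) ⟨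
  word (k ∷ l ∷ ls) ++ electrons b ∎

word-glue : ∀ {m} a (v : Vec ℕ (suc m)) b →
  word (glue a v b) ≡ electrons a ++ word v ++ electrons b
word-glue a (k ∷ ks) b = begin
  word (addLast b (a + k ∷ ks))
    ≡⟨ word-addLast b (a + k ∷ ks) ⟩
  (electrons (a + k) ++ rest) ++ electrons b
    ≡⟨ cong (λ x → (x ++ rest) ++ electrons b) (electrons-+ a k) ⟩
  ((electrons a ++ electrons k) ++ rest) ++ electrons b
    ≡⟨ cong (_++ electrons b) (++-assoc (electrons a) (electrons k) rest) ⟩
  (electrons a ++ word (k ∷ ks)) ++ electrons b
    ≡⟨ ++-assoc (electrons a) (word (k ∷ ks)) (electrons b) ⟩
  electrons a ++ word (k ∷ ks) ++ electrons b ∎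
  where rest = nucleiThenElectrons (toList ks)

word-insertVec : ∀ {n m} (k : Vec ℕ (suc (suc n))) (j : Fin (suc n)) (l : Vec ℕ (suc m)) →
  word (insertVec k j l) ≡ substitute (word k) (toℕ j) (word l)
word-insertVec {n} {m} (k₀ ∷ k₁ ∷ ks) zero l = begin
  word (Vec.cast _ (glue k₀ l k₁ Vec.++ ks))
    ≡⟨ word-cast (cong suc (+-comm m n)) (glue k₀ l k₁ Vec.++ ks) ⟩
  word (glue k₀ l k₁ Vec.++ ks)
    ≡⟨ word-++ (glue k₀ l k₁) ks ⟩
  word (glue k₀ l k₁) ++ rest
    ≡⟨ cong (_++ rest) (word-glue k₀ l k₁) ⟩
  (electrons k₀ ++ word l ++ electrons k₁) ++ rest
    ≡⟨ ++-assoc (electrons k₀) (word l ++ electrons k₁) rest ⟩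
  electrons k₀ ++ (word l ++ electrons k₁) ++ rest
    ≡⟨ cong (electrons k₀ ++_) (++-assoc (word l) (electrons k₁) rest) ⟩
  electrons k₀ ++ word l ++ electrons k₁ ++ rest
    ≡⟨ substitute-electrons-++ k₀ (nucleus ∷ electrons k₁ ++ rest) 0 (word l) ⟨
  substitute (word (k₀ ∷ k₁ ∷ ks)) 0 (word l) ∎
  where rest = nucleiThenElectrons (toList ks)
word-insertVec {suc n} (k₀ ∷ ks@(_ ∷ _)) (suc j) l = begin
  electrons k₀ ++ nucleiThenElectrons (toList (insertVec ks j l))
    ≡⟨ cong (electrons k₀ ++_) (nucleiThenElectrons-toList (insertVec ks j l)) ⟩
  electrons k₀ ++ nucleus ∷ word (insertVec ks j l)
    ≡⟨ cong (λ x → electrons k₀ ++ nucleus ∷ x) (word-insertVec ks j l) ⟩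
  electrons k₀ ++ nucleus ∷ substitute (word ks) (toℕ j) (word l)
    ≡⟨ substitute-electrons-++ k₀ (nucleus ∷ word ks) (suc (toℕ j)) (word l) ⟨
  substitute (word (k₀ ∷ ks)) (suc (toℕ j)) (word l) ∎

wordᴹ : ∀ {d n} → Molecule d n → Word
wordᴹ (mol v) = word v

wordᴹ-injective : ∀ {d n} {x y : Molecule d n} → wordᴹ x ≡ wordᴹ y → x ≡ y
wordᴹ-injective {x = mol u} {mol v} eq = cong mol (word-injective u v eq)

wordᴹ-subst : ∀ {d n m} (eq : n ≡ m) (x : Molecule d n) → wordᴹ (subst (Molecule d) eq x) ≡ wordᴹ x
wordᴹ-subst refl x = refl

nuclei-wordᴹ : ∀ {d n} (x : Molecule d n) → nuclei (wordᴹ x) ≡ n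
nuclei-wordᴹ (mol v) = nuclei-word v

wordᴹ-∘ᴹ : ∀ {d n m} (x : Molecule d (suc n)) (j : Fin (suc n)) (y : Molecule d m) →
  wordᴹ (x ∘ᴹ[ j ] y) ≡ substitute (wordᴹ x) (toℕ j) (wordᴹ y)
wordᴹ-∘ᴹ (mol k) j (mol l) = word-insertVec k j l

module _ {d : ℕ} where

  ∘ᴹ-unitˡ : ∀ {m} (x : Molecule d m) → eᴹ d 1 ∘ᴹ[ zero ] x ≡ x
  ∘ᴹ-unitˡ x = wordᴹ-injective (begin
    wordᴹ (eᴹ d 1 ∘ᴹ[ zero ] x)  ≡⟨ wordᴹ-∘ᴹ (eᴹ d 1) zero x ⟩
    wordᴹ x ++ []                ≡⟨ ++-identityʳ (wordᴹ x) ⟩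
    wordᴹ x                      ∎)

  ∘ᴹ-unitʳ : ∀ {n} (x : Molecule d (suc n)) (i : Fin (suc n)) →
    subst (Molecule d) (+-comm n 1) (x ∘ᴹ[ i ] eᴹ d 1) ≡ x
  ∘ᴹ-unitʳ {n} x i = wordᴹ-injective (begin
    wordᴹ (subst (Molecule d) (+-comm n 1) (x ∘ᴹ[ i ] eᴹ d 1))
      ≡⟨ wordᴹ-subst (+-comm n 1) (x ∘ᴹ[ i ] eᴹ d 1) ⟩
    wordᴹ (x ∘ᴹ[ i ] eᴹ d 1)
      ≡⟨ wordᴹ-∘ᴹ x i (eᴹ d 1) ⟩
    substitute (wordᴹ x) (toℕ i) [ nucleus ]
      ≡⟨ substitute-nucleus (wordᴹ x) (toℕ i) ⟩
    wordᴹ x ∎)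

  ∘ᴹ-seqAssoc : ∀ {a b c} (x : Molecule d (suc a)) (y : Molecule d (suc b)) (z : Molecule d c)
    (i : Fin (suc a)) (j : Fin (suc b)) (k : Fin (suc (a + b))) → toℕ k ≡ toℕ i + toℕ j →
    subst (Molecule d) (+-suc a b) (x ∘ᴹ[ i ] y) ∘ᴹ[ k ] z
      ≡ subst (Molecule d) (sym (+-assoc a b c)) (x ∘ᴹ[ i ] (y ∘ᴹ[ j ] z))
  ∘ᴹ-seqAssoc {a} {b} {c} x y z i j k k≡i+j = wordᴹ-injective (begin
    wordᴹ (subst (Molecule d) (+-suc a b) (x ∘ᴹ[ i ] y) ∘ᴹ[ k ] z)
      ≡⟨ wordᴹ-∘ᴹ (subst (Molecule d) (+-suc a b) (x ∘ᴹ[ i ] y)) k z ⟩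
    substitute (wordᴹ (subst (Molecule d) (+-suc a b) (x ∘ᴹ[ i ] y))) (toℕ k) (wordᴹ z)
      ≡⟨ cong₂ (λ u l → substitute u l (wordᴹ z))
               (trans (wordᴹ-subst (+-suc a b) _) (wordᴹ-∘ᴹ x i y)) k≡i+j ⟩
    substitute (substitute (wordᴹ x) (toℕ i) (wordᴹ y)) (toℕ i + toℕ j) (wordᴹ z)
      ≡⟨ substitute-seqAssoc (wordᴹ x) (toℕ i) (wordᴹ y) (toℕ j) (wordᴹ z) j<nuclei ⟩
    substitute (wordᴹ x) (toℕ i) (substitute (wordᴹ y) (toℕ j) (wordᴹ z))
      ≡⟨ cong (substitute (wordᴹ x) (toℕ i)) (wordᴹ-∘ᴹ y j z) ⟨
    substitute (wordᴹ x) (toℕ i) (wordᴹ (y ∘ᴹ[ j ] z))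
      ≡⟨ wordᴹ-∘ᴹ x i (y ∘ᴹ[ j ] z) ⟨
    wordᴹ (x ∘ᴹ[ i ] (y ∘ᴹ[ j ] z))
      ≡⟨ wordᴹ-subst (sym (+-assoc a b c)) _ ⟨
    wordᴹ (subst (Molecule d) (sym (+-assoc a b c)) (x ∘ᴹ[ i ] (y ∘ᴹ[ j ] z))) ∎)
    where
    j<nuclei : toℕ j < nuclei (wordᴹ y)
    j<nuclei = subst (toℕ j <_) (sym (nuclei-wordᴹ y)) (toℕ<n j)

  ∘ᴹ-parAssoc : ∀ {a b c} (x : Molecule d (suc (suc a))) (y : Molecule d b) (z : Molecule d c)
    (i j : Fin (suc (suc a))) → toℕ i < toℕ j →
    (j' : Fin (suc (a + b))) → toℕ j' ≡ toℕ j + b ∸ 1 →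
    (i' : Fin (suc (a + c))) → toℕ i' ≡ toℕ i →
    subst (Molecule d) (swap-arity a b c) ((x ∘ᴹ[ i ] y) ∘ᴹ[ j' ] z) ≡ (x ∘ᴹ[ j ] z) ∘ᴹ[ i' ] y
  ∘ᴹ-parAssoc {a} {b} {c} x y z i (suc j) (s≤s i≤j) j' j'≡j+b i' i'≡i = wordᴹ-injective (begin
    wordᴹ (subst (Molecule d) (swap-arity a b c) ((x ∘ᴹ[ i ] y) ∘ᴹ[ j' ] z))
      ≡⟨ wordᴹ-subst (swap-arity a b c) _ ⟩
    wordᴹ ((x ∘ᴹ[ i ] y) ∘ᴹ[ j' ] z)
      ≡⟨ wordᴹ-∘ᴹ (x ∘ᴹ[ i ] y) j' z ⟩
    substitute (wordᴹ (x ∘ᴹ[ i ] y)) (toℕ j') (wordᴹ z)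
      ≡⟨ cong₂ (λ u l → substitute u l (wordᴹ z)) (wordᴹ-∘ᴹ x i y)
               (trans j'≡j+b (cong (toℕ j +_) (sym (nuclei-wordᴹ y)))) ⟩
    substitute (substitute (wordᴹ x) (toℕ i) (wordᴹ y)) (toℕ j + nuclei (wordᴹ y)) (wordᴹ z)
      ≡⟨ substitute-parAssoc (wordᴹ x) (toℕ i) (toℕ j) (wordᴹ y) (wordᴹ z) i≤j ⟩
    substitute (substitute (wordᴹ x) (suc (toℕ j)) (wordᴹ z)) (toℕ i) (wordᴹ y)
      ≡⟨ cong₂ (λ u l → substitute u l (wordᴹ y)) (wordᴹ-∘ᴹ x (suc j) z) i'≡i ⟨
    substitute (wordᴹ (x ∘ᴹ[ suc j ] z)) (toℕ i') (wordᴹ y)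
      ≡⟨ wordᴹ-∘ᴹ (x ∘ᴹ[ suc j ] z) i' y ⟨
    wordᴹ ((x ∘ᴹ[ suc j ] z) ∘ᴹ[ i' ] y) ∎)

mainTheorem2 : (d : ℕ) → 0 < d →
    IsOperadWithMultiplication (Molecule d) (eᴹ d 1) _∘ᴹ[_]_ (eᴹ d 0) (eᴹ d 2)
mainTheorem2 d _ = record
  { isPlanarOperad = record
    { unitˡ    = ∘ᴹ-unitˡ
    ; unitʳ    = ∘ᴹ-unitʳ
    ; seqAssoc = ∘ᴹ-seqAssoc
    ; parAssoc = ∘ᴹ-parAssoc
    }
  ; μ-assoc = refl
  ; μ-unitˡ = refl
  ; μ-unitʳ = refl
  }
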